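{- Let $r \ge 1$, let $A$ be the $2^r \times r$ binary code matrix and $M = AA^T$. For $0 \le k \le r$ let $\mathfrak{m}_k$ be the $2^r \times \binom{r}{k}$ submatrix of $M$ consisting of the columns $M_{*,\ell}$ for which row $\ell$ of $A$ has exactly $k$ entries equal to $1$. Then the rank over $\mathbb{Z}/2\mathbb{Z}$ of $\mathfrak{m}_{2^i}^{[i]}$ equals $\binom{r}{2^i}$ for all $i \ge 1$.
   Context: The binary code matrix $A \in \{0,1\}^{2^r \times r}$ is the matrix whose rows are all $2^r$ distinct vectors in $\{0,1\}^r$ (the binary expansions of $0,1,\ldots,2^r-1$), ordered so that rows with fewer nonzero entries come first. For an integer matrix $X$ with nonnegative entries, its $2$-adic expansion is $X = X^{[0]} + 2X^{[1]} + 4 X^{[2]} + \cdots$ with each $X^{[i]}$ having entries in $\{0,1\}$ (the $i$th binary digit, taken entrywise). When $2^i > r$ the matrix $\mathfrak{m}_{2^i}$ is empty and has rank $0 = \binom{r}{2^i}$. -}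

module Defs where

open import Data.Bool using (Bool; true; false; _xor_; if_then_else_)
open import Data.Nat using (ℕ; zero; suc; _+_; _*_; _^_; _≤_; _≡ᵇ_; _/_; _%_)
open import Data.List using (List; []; _∷_; _++_; map; concatMap; filterᵇ; upTo; length; zipWith)
open import Data.Nat.ListAction using (sum)
open import Data.List.Relation.Unary.All using (All)
open import Data.Vec as V using (Vec)
open import Data.Product using (Σ; _×_)
open import Relation.Binary.PropositionalEquality using (_≡_)

weight : List Bool → ℕ
weight []           = 0
weight (true  ∷ xs) = suc (weight xs)
weight (false ∷ xs) = weight xs

allBits : ℕ → List (List Bool)
allBits zero    = [] ∷ []
allBits (suc r) = map (false ∷_) (allBits r) ++ map (true ∷_) (allBits r)

-- Rows of the binary code matrix A (2^r × r): all of {0,1}^r, rows with fewer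
-- nonzero entries first (ties broken by the numerical order of the expansion).
codeRows : ℕ → List (List Bool)
codeRows r = concatMap (λ k → filterᵇ (λ v → weight v ≡ᵇ k) (allBits r)) (upTo (suc r))

b2n : Bool → ℕ
b2n true  = 1
b2n false = 0

dot : List Bool → List Bool → ℕ
dot u v = sum (zipWith (λ a b → b2n a * b2n b) u v)

matM : ℕ → List (List ℕ)
matM r = map (λ u → map (λ v → dot u v) (codeRows r)) (codeRows r)

keepCols : ℕ → List (List Bool) → List ℕ → List ℕ
keepCols k []       _        = []
keepCols k (_ ∷ _)  []       = []
keepCols k (a ∷ as) (x ∷ xs) =
  if weight a ≡ᵇ k then x ∷ keepCols k as xs else keepCols k as xs

frakm : ℕ → ℕ → List (List ℕ)
frakm r k = map (keepCols k (codeRows r)) (matM r)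

digit : ℕ → ℕ → Bool
digit zero    n = (n % 2) ≡ᵇ 1
digit (suc i) n = digit i (n / 2)

-- X^{[i]} : entrywise i-th binary digit of a nonnegative integer matrix.
digitMat : ℕ → List (List ℕ) → List (List Bool)
digitMat i X = map (map (digit i)) X

addV : List Bool → List Bool → List Bool
addV []       ys       = ys
addV xs       []       = xs
addV (x ∷ xs) (y ∷ ys) = (x xor y) ∷ addV xs ys

lincomb : (L : List (List Bool)) → Vec Bool (length L) → List Bool
lincomb []       V.[]          = []
lincomb (x ∷ xs) (true  V.∷ c) = addV x (lincomb xs c)
lincomb (x ∷ xs) (false V.∷ c) = lincomb xs c

IsZeroV : List Bool → Set
IsZeroV v = All (_≡ false) v

LinIndep : List (List Bool) → Set
LinIndep L = (c : Vec Bool (length L)) → IsZeroV (lincomb L c) → c ≡ V.replicate (length L) false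

select : (L : List (List Bool)) → Vec Bool (length L) → List (List Bool)
select []       V.[]          = []
select (x ∷ xs) (true  V.∷ s) = x ∷ select xs s
select (x ∷ xs) (false V.∷ s) = select xs s

HasRankGF2 : List (List Bool) → ℕ → Set
HasRankGF2 X k =
  Σ (Vec Bool (length X)) (λ s → LinIndep (select X s) × length (select X s) ≡ k)
  × ((s : Vec Bool (length X)) → LinIndep (select X s) → length (select X s) ≤ k)

{-# OPTIONS --safe #-}
-- Let k = 2 ^ i and let W be the rows of A of weight k. For u, v ∈ W we have ⟨u , v⟩ ≤ k,
-- with equality iff u = v, so the i-th binary digit of M_{u,v} is the Kronecker delta:
-- the rows of 𝔪_k^{[i]} indexed by W form an identity matrix of size (r choose k).
-- Conversely 𝔪_k^{[i]} has only (r choose k) columns, and m independent rows of width n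
-- give an injection {0,1}^m → {0,1}^n, whence m ≤ n.
module Submission where

open import Defs
open import Algebra.Bundles using (CommutativeRing)
open import Algebra.Properties.CommutativeSemigroup using (interchange)
open import Data.Bool using (Bool; true; false; _∧_; _xor_)
open import Data.Bool.Properties
  using (xor-∧-commutativeRing; ∧-distribʳ-xor; ∧-zeroʳ; xor-identityʳ; xor-same)
open import Data.Empty using (⊥)
open import Data.Fin as Fin using (Fin; toℕ; combine; quotient; remainder)
open import Data.Fin.Properties using (injective⇒≤; combine-injective; combine-remQuot)
open import Data.List using (List; []; _∷_; _++_; [_]; length; map; filterᵇ; concatMap; upTo)
import Data.List.Properties as List
open import Data.List.Membership.Propositional using (_∈_)
open import Data.List.Membership.Propositional.Properties using (∈-map⁻)
open import Data.List.Relation.Unary.All as All using (All; []; _∷_)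
import Data.List.Relation.Unary.All.Properties as All
open import Data.List.Relation.Unary.AllPairs using ([]; _∷_)
open import Data.List.Relation.Unary.Any using (here; there; index)
open import Data.List.Relation.Unary.Unique.Propositional using (Unique)
import Data.List.Relation.Unary.Unique.Propositional.Properties as Unique
open import Data.Nat using (ℕ; zero; suc; _+_; _^_; _≤_; _<_; _≡ᵇ_; _/_; z≤n; s≤s)
open import Data.Nat.Combinatorics using (_C_; k>n⇒nCk≡0; nCk+nC[k+1]≡[n+1]C[k+1])
open import Data.Nat.DivMod using (m<n*o⇒m/o<n; m*n/n≡m)
open import Data.Nat.Properties
  using ( _<?_; ≡ᵇ⇒≡; +-comm; *-comm; suc-injective; ≤-refl; ≤-reflexive; <⇒≤; <⇒≢; <⇒≱; ≮⇒≥
        ; ≤∧≢⇒<; 1+n≰n; m≤n⇒m≤1+n; m≤n⇒m<n∨m≡n; ^-monoʳ-<)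
open import Data.Product using (∃; _×_; _,_)
open import Data.Sum using (inj₁; inj₂)
open import Data.Vec as Vec using (Vec)
open import Data.Vec.Properties using (∷-injectiveˡ; ∷-injectiveʳ)
open import Function using (_∘_)
open import Function.Definitions using (Injective)
open import Relation.Binary.PropositionalEquality
  using (_≡_; _≢_; refl; sym; trans; cong; cong₂; subst; subst₂; ≢-sym; module ≡-Reasoning)
open import Relation.Nullary using (Dec; yes; no; contradiction)
open import Relation.Nullary.Decidable using (T?)

-- Vectors over GF(2)

-- Reading past the end of a row gives false: rows of unequal length act as zero-padded vectors, as in addV.
entry : List Bool → ℕ → Bool
entry []       _       = false
entry (x ∷ _)  zero    = x
entry (_ ∷ xs) (suc j) = entry xs j

entry-addV : ∀ u v j → entry (addV u v) j ≡ entry u j xor entry v j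
entry-addV []       v        j       = refl
entry-addV (x ∷ xs) []       j       = sym (xor-identityʳ _)
entry-addV (x ∷ xs) (y ∷ ys) zero    = refl
entry-addV (x ∷ xs) (y ∷ ys) (suc j) = entry-addV xs ys j

IsZeroV⇒entry≡false : ∀ {v} → IsZeroV v → ∀ j → entry v j ≡ false
IsZeroV⇒entry≡false []        j       = refl
IsZeroV⇒entry≡false (px ∷ _)  zero    = px
IsZeroV⇒entry≡false (_ ∷ pxs) (suc j) = IsZeroV⇒entry≡false pxs j

entry≡false⇒IsZeroV : ∀ v → (∀ j → entry v j ≡ false) → IsZeroV v
entry≡false⇒IsZeroV []       _ = []
entry≡false⇒IsZeroV (x ∷ xs) h = h 0 ∷ entry≡false⇒IsZeroV xs (h ∘ suc)

entry-beyond-length : ∀ v {j} → length v ≤ j → entry v j ≡ false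
entry-beyond-length []       _         = refl
entry-beyond-length (x ∷ xs) (s≤s len) = entry-beyond-length xs len

length-addV-≤ : ∀ {n} u v → length u ≤ n → length v ≤ n → length (addV u v) ≤ n
length-addV-≤ []       v        _         lv        = lv
length-addV-≤ (x ∷ xs) []       lu        _         = lu
length-addV-≤ (x ∷ xs) (y ∷ ys) (s≤s lu) (s≤s lv) = s≤s (length-addV-≤ xs ys lu lv)

length-lincomb-≤ : ∀ {n} L (c : Vec Bool (length L)) →
                   All (λ x → length x ≤ n) L → length (lincomb L c) ≤ n
length-lincomb-≤ []      Vec.[]           _          = z≤n
length-lincomb-≤ (x ∷ L) (true  Vec.∷ c) (lx ∷ lL) = length-addV-≤ x _ lx (length-lincomb-≤ L c lL)
length-lincomb-≤ (x ∷ L) (false Vec.∷ c) (_  ∷ lL) = length-lincomb-≤ L c lL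

entry-lincomb-∷ : ∀ x L b (c : Vec Bool (length L)) j →
                  entry (lincomb (x ∷ L) (b Vec.∷ c)) j ≡ (b ∧ entry x j) xor entry (lincomb L c) j
entry-lincomb-∷ x L true  c j = entry-addV x (lincomb L c) j
entry-lincomb-∷ x L false c j = refl

_⊕_ : ∀ {m} → Vec Bool m → Vec Bool m → Vec Bool m
_⊕_ = Vec.zipWith _xor_

entry-lincomb-⊕ : ∀ L (c d : Vec Bool (length L)) j →
  entry (lincomb L (c ⊕ d)) j ≡ entry (lincomb L c) j xor entry (lincomb L d) j
entry-lincomb-⊕ []      Vec.[]      Vec.[]      j = refl
entry-lincomb-⊕ (x ∷ L) (p Vec.∷ c) (q Vec.∷ d) j = begin
  entry (lincomb (x ∷ L) ((p xor q) Vec.∷ (c ⊕ d))) j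
    ≡⟨ entry-lincomb-∷ x L (p xor q) (c ⊕ d) j ⟩
  ((p xor q) ∧ e) xor entry (lincomb L (c ⊕ d)) j
    ≡⟨ cong₂ _xor_ (∧-distribʳ-xor e p q) (entry-lincomb-⊕ L c d j) ⟩
  ((p ∧ e) xor (q ∧ e)) xor (entry (lincomb L c) j xor entry (lincomb L d) j)
    ≡⟨ interchange xor-semigroup (p ∧ e) (q ∧ e) _ _ ⟩
  ((p ∧ e) xor entry (lincomb L c) j) xor ((q ∧ e) xor entry (lincomb L d) j)
    ≡⟨ sym (cong₂ _xor_ (entry-lincomb-∷ x L p c j) (entry-lincomb-∷ x L q d j)) ⟩
  entry (lincomb (x ∷ L) (p Vec.∷ c)) j xor entry (lincomb (x ∷ L) (q Vec.∷ d)) j ∎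
  where
  open ≡-Reasoning
  e = entry x j
  xor-semigroup = CommutativeRing.+-commutativeSemigroup xor-∧-commutativeRing

⊕≡replicate⇒≡ : ∀ {m} (c d : Vec Bool m) → c ⊕ d ≡ Vec.replicate m false → c ≡ d
⊕≡replicate⇒≡ Vec.[]          Vec.[]          _  = refl
⊕≡replicate⇒≡ (true  Vec.∷ c) (true  Vec.∷ d) eq = cong (true Vec.∷_) (⊕≡replicate⇒≡ c d (cong Vec.tail eq))
⊕≡replicate⇒≡ (false Vec.∷ c) (false Vec.∷ d) eq = cong (false Vec.∷_) (⊕≡replicate⇒≡ c d (cong Vec.tail eq))
⊕≡replicate⇒≡ (true  Vec.∷ c) (false Vec.∷ d) ()
⊕≡replicate⇒≡ (false Vec.∷ c) (true  Vec.∷ d) ()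

lincomb-injective : ∀ {L} → LinIndep L → ∀ {c d} →
  (∀ j → entry (lincomb L c) j ≡ entry (lincomb L d) j) → c ≡ d
lincomb-injective {L} indep {c} {d} same = ⊕≡replicate⇒≡ c d (indep (c ⊕ d) (entry≡false⇒IsZeroV _ zero-entry))
  where
  zero-entry : ∀ j → entry (lincomb L (c ⊕ d)) j ≡ false
  zero-entry j = begin
    entry (lincomb L (c ⊕ d)) j                          ≡⟨ entry-lincomb-⊕ L c d j ⟩
    entry (lincomb L c) j xor entry (lincomb L d) j      ≡⟨ cong (_xor entry (lincomb L d) j) (same j) ⟩
    entry (lincomb L d) j xor entry (lincomb L d) j      ≡⟨ xor-same (entry (lincomb L d) j) ⟩
    false                                                ∎
    where open ≡-Reasoning

-- Counting Boolean vectors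

bit : Bool → Fin 2
bit false = Fin.zero
bit true  = Fin.suc Fin.zero

unbit : Fin 2 → Bool
unbit Fin.zero           = false
unbit (Fin.suc Fin.zero) = true

bit-unbit : ∀ b → bit (unbit b) ≡ b
bit-unbit Fin.zero           = refl
bit-unbit (Fin.suc Fin.zero) = refl

bit-injective : Injective _≡_ _≡_ bit
bit-injective {false} {false} _ = refl
bit-injective {true}  {true}  _ = refl

toFin : ∀ {n} → Vec Bool n → Fin (2 ^ n)
toFin Vec.[]       = Fin.zero
toFin (b Vec.∷ v) = combine (bit b) (toFin v)

fromFin : ∀ n → Fin (2 ^ n) → Vec Bool n
fromFin zero    _ = Vec.[]
fromFin (suc n) x = unbit (quotient (2 ^ n) x) Vec.∷ fromFin n (remainder {2} (2 ^ n) x)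

toFin-injective : ∀ {n} → Injective _≡_ _≡_ (toFin {n})
toFin-injective {x = Vec.[]}      {Vec.[]}      _  = refl
toFin-injective {x = b Vec.∷ v} {c Vec.∷ w} eq =
  let bits , rest = combine-injective (bit b) (toFin v) (bit c) (toFin w) eq
  in cong₂ Vec._∷_ (bit-injective bits) (toFin-injective rest)

toFin-fromFin : ∀ n x → toFin (fromFin n x) ≡ x
toFin-fromFin zero    Fin.zero = refl
toFin-fromFin (suc n) x = trans
  (cong₂ combine (bit-unbit (quotient (2 ^ n) x)) (toFin-fromFin n (remainder {2} (2 ^ n) x)))
  (combine-remQuot {2} (2 ^ n) x)

injection⇒≤ : ∀ {m n} (f : Vec Bool m → Vec Bool n) → Injective _≡_ _≡_ f → m ≤ n
injection⇒≤ {m} {n} f f-injective = ≮⇒≥ λ n<m → <⇒≱ (^-monoʳ-< 2 (s≤s (s≤s z≤n)) n<m) 2^m≤2^n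
  where
  2^m≤2^n : 2 ^ m ≤ 2 ^ n
  2^m≤2^n = injective⇒≤ {f = toFin ∘ f ∘ fromFin m} λ {x} {y} eq → begin
    x                        ≡⟨ sym (toFin-fromFin m x) ⟩
    toFin (fromFin m x)      ≡⟨ cong toFin (f-injective (toFin-injective eq)) ⟩
    toFin (fromFin m y)      ≡⟨ toFin-fromFin m y ⟩
    y                        ∎
    where open ≡-Reasoning

window : (n : ℕ) → List Bool → Vec Bool n
window zero    _        = Vec.[]
window (suc n) []       = false Vec.∷ window n []
window (suc n) (x ∷ xs) = x Vec.∷ window n xs

window-injective : ∀ n u v → length u ≤ n → length v ≤ n →
                   window n u ≡ window n v → ∀ j → entry u j ≡ entry v j
window-injective zero    []       []       _         _         _  j       = refl
window-injective (suc n) []       []       _         _         _  j       = refl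
window-injective (suc n) (x ∷ xs) (y ∷ ys) _         _         eq zero    = ∷-injectiveˡ eq
window-injective (suc n) (x ∷ xs) (y ∷ ys) (s≤s lu) (s≤s lv) eq (suc j) =
  window-injective n xs ys lu lv (∷-injectiveʳ eq) j
window-injective (suc n) []       (y ∷ ys) _         _         eq zero    = ∷-injectiveˡ eq
window-injective (suc n) []       (y ∷ ys) _         (s≤s lv) eq (suc j) =
  window-injective n [] ys z≤n lv (∷-injectiveʳ eq) j
window-injective (suc n) (x ∷ xs) []       _         _         eq zero    = ∷-injectiveˡ eq
window-injective (suc n) (x ∷ xs) []       (s≤s lu) _         eq (suc j) =
  window-injective n xs [] lu z≤n (∷-injectiveʳ eq) j

LinIndep⇒length≤ : ∀ {n} L → All (λ x → length x ≤ n) L → LinIndep L → length L ≤ n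
LinIndep⇒length≤ {n} L short indep = injection⇒≤ (window n ∘ lincomb L) λ {c} {d} eq →
  lincomb-injective {L} indep
    (window-injective n _ _ (length-lincomb-≤ L c short) (length-lincomb-≤ L d short) eq)

select⁺ : ∀ {P : List Bool → Set} L s → All P L → All P (select L s)
select⁺ []      Vec.[]           []         = []
select⁺ (x ∷ L) (true  Vec.∷ s) (px ∷ pL) = px ∷ select⁺ L s pL
select⁺ (x ∷ L) (false Vec.∷ s) (_  ∷ pL) = select⁺ L s pL

LinIndep-select⇒HasRankGF2 : ∀ X s → LinIndep (select X s) →
  All (λ x → length x ≤ length (select X s)) X → HasRankGF2 X (length (select X s))
LinIndep-select⇒HasRankGF2 X s indep short =
  (s , indep , refl) , λ t indep′ → LinIndep⇒length≤ (select X t) (select⁺ X t short) indep′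

entry-lincomb-column : ∀ {p} L (c : Vec Bool (length L)) →
  All (λ y → entry y p ≡ false) L → entry (lincomb L c) p ≡ false
entry-lincomb-column {p} []      Vec.[]      []         = refl
entry-lincomb-column {p} (x ∷ L) (b Vec.∷ c) (px ∷ pL) = begin
  entry (lincomb (x ∷ L) (b Vec.∷ c)) p        ≡⟨ entry-lincomb-∷ x L b c p ⟩
  (b ∧ entry x p) xor entry (lincomb L c) p    ≡⟨ cong₂ (λ e f → (b ∧ e) xor f) px (entry-lincomb-column L c pL) ⟩
  (b ∧ false) xor false                        ≡⟨ xor-identityʳ (b ∧ false) ⟩
  b ∧ false                                    ≡⟨ ∧-zeroʳ b ⟩
  false                                        ∎
  where open ≡-Reasoning

LinIndep-∷ : ∀ {x L p} → LinIndep L → entry x p ≡ true →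
  All (λ y → entry y p ≡ false) L → LinIndep (x ∷ L)
LinIndep-∷ {x} {L} {p} indep pivot column (true Vec.∷ c) zero-comb = contradiction true≡false λ ()
  where
  open ≡-Reasoning
  true≡false : true ≡ false
  true≡false = begin
    true xor false                              ≡⟨ sym (cong₂ _xor_ pivot (entry-lincomb-column L c column)) ⟩
    entry x p xor entry (lincomb L c) p         ≡⟨ sym (entry-addV x (lincomb L c) p) ⟩
    entry (lincomb (x ∷ L) (true Vec.∷ c)) p    ≡⟨ IsZeroV⇒entry≡false zero-comb p ⟩
    false                                       ∎
LinIndep-∷ indep pivot column (false Vec.∷ c) zero-comb = cong (false Vec.∷_) (indep c zero-comb)

entry-map-∈ : ∀ {A : Set} (g : A → Bool) {u W} (u∈W : u ∈ W) →
              entry (map g W) (toℕ (index u∈W)) ≡ g u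
entry-map-∈ g (here refl) = refl
entry-map-∈ g (there u∈W) = entry-map-∈ g u∈W

module _ {A : Set} {P : A → Set} (f : A → A → Bool)
         (diagonal : ∀ {u} → P u → f u u ≡ true)
         (off-diagonal : ∀ {u v} → P u → P v → u ≢ v → f u v ≡ false) where

  identity-rows-independent : ∀ {W} → All P W → Unique W → LinIndep (map (λ u → map (f u) W) W)
  identity-rows-independent {W} PW = rows-independent W (All.tabulate λ u∈W → u∈W)
    where
    rows-independent : ∀ U → All (_∈ W) U → Unique U → LinIndep (map (λ u → map (f u) W) U)
    rows-independent []      []            _               = λ { Vec.[] _ → refl }
    rows-independent (u ∷ U) (u∈W ∷ U⊆W) (u∉U ∷ uniqueU) =
      LinIndep-∷ (rows-independent U U⊆W uniqueU) pivot (All.map⁺ (All.zipWith zero-at-pivot (U⊆W , u∉U)))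
      where
      Pu : P u
      Pu = All.lookup PW u∈W
      pivot : entry (map (f u) W) (toℕ (index u∈W)) ≡ true
      pivot = trans (entry-map-∈ (f u) u∈W) (diagonal Pu)
      zero-at-pivot : ∀ {v} → v ∈ W × u ≢ v → entry (map (f v) W) (toℕ (index u∈W)) ≡ false
      zero-at-pivot {v} (v∈W , u≢v) =
        trans (entry-map-∈ (f v) u∈W) (off-diagonal (All.lookup PW v∈W) Pu (≢-sym u≢v))

ofWeight : ℕ → List (List Bool) → List (List Bool)
ofWeight k = filterᵇ (λ v → weight v ≡ᵇ k)

filterᵇ-map : ∀ {A B : Set} (p : B → Bool) (f : A → B) xs →
              filterᵇ p (map f xs) ≡ map f (filterᵇ (p ∘ f) xs)
filterᵇ-map p f []       = refl
filterᵇ-map p f (x ∷ xs) with p (f x)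
... | true  = cong (f x ∷_) (filterᵇ-map p f xs)
... | false = filterᵇ-map p f xs

filterᵇ-concatMap : ∀ {A B : Set} (p : B → Bool) (g : A → List B) xs →
                    filterᵇ p (concatMap g xs) ≡ concatMap (filterᵇ p ∘ g) xs
filterᵇ-concatMap p g []       = refl
filterᵇ-concatMap p g (x ∷ xs) =
  trans (List.filter-++ (T? ∘ p) (g x) (concatMap g xs)) (cong (filterᵇ p (g x) ++_) (filterᵇ-concatMap p g xs))

length-ofWeight-allBits : ∀ r k → length (ofWeight k (allBits r)) ≡ r C k
length-ofWeight-allBits zero    zero    = refl
length-ofWeight-allBits zero    (suc k) = refl
length-ofWeight-allBits (suc r) k       = begin
  length (ofWeight k (map (false ∷_) B ++ map (true ∷_) B))
    ≡⟨ cong length (List.filter-++ (T? ∘ λ v → weight v ≡ᵇ k) (map (false ∷_) B) (map (true ∷_) B)) ⟩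
  length (ofWeight k (map (false ∷_) B) ++ ofWeight k (map (true ∷_) B))
    ≡⟨ List.length-++ (ofWeight k (map (false ∷_) B)) ⟩
  length (ofWeight k (map (false ∷_) B)) + length (ofWeight k (map (true ∷_) B))
    ≡⟨ cong₂ _+_ (length-ofWeight-map (false ∷_)) (length-ofWeight-map (true ∷_)) ⟩
  length (ofWeight k B) + length (filterᵇ (λ v → suc (weight v) ≡ᵇ k) B)
    ≡⟨ cong (_+ length (filterᵇ (λ v → suc (weight v) ≡ᵇ k) B)) (length-ofWeight-allBits r k) ⟩
  r C k + length (filterᵇ (λ v → suc (weight v) ≡ᵇ k) B)
    ≡⟨ pascal k ⟩
  suc r C k ∎
  where
  open ≡-Reasoning
  B = allBits r
  length-ofWeight-map : ∀ f → length (ofWeight k (map f B)) ≡ length (filterᵇ ((λ v → weight v ≡ᵇ k) ∘ f) B)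
  length-ofWeight-map f = trans (cong length (filterᵇ-map _ f B)) (List.length-map f (filterᵇ ((λ v → weight v ≡ᵇ k) ∘ f) B))
  pascal : ∀ k → r C k + length (filterᵇ (λ v → suc (weight v) ≡ᵇ k) B) ≡ suc r C k
  pascal zero    rewrite List.filter-none (T? ∘ λ _ → false) (All.universal (λ _ ()) B) = refl
  pascal (suc k) = begin
    r C suc k + length (ofWeight k B) ≡⟨ cong (r C suc k +_) (length-ofWeight-allBits r k) ⟩
    r C suc k + r C k                 ≡⟨ +-comm (r C suc k) (r C k) ⟩
    r C k + r C suc k                 ≡⟨ nCk+nC[k+1]≡[n+1]C[k+1] r k ⟩
    suc r C suc k                     ∎

allBits-length : ∀ r → All (λ v → length v ≡ r) (allBits r)
allBits-length zero    = refl ∷ []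
allBits-length (suc r) = All.++⁺ (All.map⁺ (All.map (cong suc) (allBits-length r)))
                                 (All.map⁺ (All.map (cong suc) (allBits-length r)))

allBits-unique : ∀ r → Unique (allBits r)
allBits-unique zero    = [] ∷ []
allBits-unique (suc r) = Unique.++⁺ (Unique.map⁺ List.∷-injectiveʳ (allBits-unique r))
                                    (Unique.map⁺ List.∷-injectiveʳ (allBits-unique r))
                                    disjoint
  where
  disjoint : ∀ {v} → v ∈ map (false ∷_) (allBits r) × v ∈ map (true ∷_) (allBits r) → ⊥
  disjoint (p , q) with ∈-map⁻ (false ∷_) p | ∈-map⁻ (true ∷_) q
  ... | _ , _ , refl | _ , _ , ()

module _ {A : Set} (h : ℕ → List A) {k} (vanishes : ∀ {j} → j ≢ k → h j ≡ []) where

  concatMap-upTo-suc : ∀ n → concatMap h (upTo (suc n)) ≡ concatMap h (upTo n) ++ h n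
  concatMap-upTo-suc n = begin
    concatMap h (upTo (suc n))              ≡⟨ cong (concatMap h) (List.upTo-∷ʳ n) ⟨
    concatMap h (upTo n ++ [ n ])           ≡⟨ List.concatMap-++ h (upTo n) [ n ] ⟩
    concatMap h (upTo n) ++ (h n ++ [])     ≡⟨ cong (concatMap h (upTo n) ++_) (List.++-identityʳ (h n)) ⟩
    concatMap h (upTo n) ++ h n             ∎
    where open ≡-Reasoning

  concatMap-upTo-≤ : ∀ {n} → n ≤ k → concatMap h (upTo n) ≡ []
  concatMap-upTo-≤ {zero}  _   = refl
  concatMap-upTo-≤ {suc n} n<k = begin
    concatMap h (upTo (suc n))      ≡⟨ concatMap-upTo-suc n ⟩
    concatMap h (upTo n) ++ h n     ≡⟨ cong₂ _++_ (concatMap-upTo-≤ (<⇒≤ n<k)) (vanishes (<⇒≢ n<k)) ⟩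
    []                              ∎
    where open ≡-Reasoning

  concatMap-upTo-> : ∀ {n} → k < n → concatMap h (upTo n) ≡ h k
  concatMap-upTo-> {suc n} (s≤s k≤n) with m≤n⇒m<n∨m≡n k≤n
  ... | inj₁ k<n = begin
    concatMap h (upTo (suc n))      ≡⟨ concatMap-upTo-suc n ⟩
    concatMap h (upTo n) ++ h n     ≡⟨ cong₂ _++_ (concatMap-upTo-> k<n) (vanishes (≢-sym (<⇒≢ k<n))) ⟩
    h k ++ []                       ≡⟨ List.++-identityʳ (h k) ⟩
    h k                             ∎
    where open ≡-Reasoning
  ... | inj₂ refl = trans (concatMap-upTo-suc n) (cong (_++ h n) (concatMap-upTo-≤ ≤-refl))

ofWeight-ofWeight-≢ : ∀ {j k} → j ≢ k → ∀ B → ofWeight k (ofWeight j B) ≡ []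
ofWeight-ofWeight-≢ {j} {k} j≢k B = List.filter-none (T? ∘ λ v → weight v ≡ᵇ k)
  (All.map (λ {v} weight≡j weight≡k → j≢k (trans (sym (≡ᵇ⇒≡ (weight v) j weight≡j)) (≡ᵇ⇒≡ (weight v) k weight≡k)))
           (All.all-filter (T? ∘ λ v → weight v ≡ᵇ j) B))

ofWeight-codeRows : ∀ r k → ofWeight k (codeRows r) ≡ ofWeight k (allBits r)
ofWeight-codeRows r k =
  trans (filterᵇ-concatMap (λ v → weight v ≡ᵇ k) (λ j → ofWeight j B) (upTo (suc r))) (by-range (k <? suc r))
  where
  B = allBits r
  h : ℕ → List (List Bool)
  h j = ofWeight k (ofWeight j B)
  vanishes : ∀ {j} → j ≢ k → h j ≡ []
  vanishes j≢k = ofWeight-ofWeight-≢ j≢k B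
  length≡0⇒≡[] : ∀ {xs : List (List Bool)} → length xs ≡ 0 → xs ≡ []
  length≡0⇒≡[] {[]} _ = refl
  by-range : Dec (k < suc r) → concatMap h (upTo (suc r)) ≡ ofWeight k B
  by-range (yes k≤r) = trans (concatMap-upTo-> h vanishes k≤r) (List.filter-idem (T? ∘ λ v → weight v ≡ᵇ k) B)
  by-range (no k≰r)  = trans (concatMap-upTo-≤ h vanishes (≮⇒≥ k≰r))
    (sym (length≡0⇒≡[] (trans (length-ofWeight-allBits r k) (k>n⇒nCk≡0 (≮⇒≥ k≰r)))))

length-ofWeight-codeRows : ∀ r k → length (ofWeight k (codeRows r)) ≡ r C k
length-ofWeight-codeRows r k = trans (cong length (ofWeight-codeRows r k)) (length-ofWeight-allBits r k)

ofWeight-codeRows-unique : ∀ r k → Unique (ofWeight k (codeRows r))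
ofWeight-codeRows-unique r k rewrite ofWeight-codeRows r k =
  Unique.filter⁺ (T? ∘ λ v → weight v ≡ᵇ k) (allBits-unique r)

ofWeight-codeRows-shape : ∀ r k → All (λ v → length v ≡ r × weight v ≡ k) (ofWeight k (codeRows r))
ofWeight-codeRows-shape r k rewrite ofWeight-codeRows r k = All.zip
  ( All.filter⁺ (T? ∘ λ v → weight v ≡ᵇ k) (allBits-length r)
  , All.map (λ {v} → ≡ᵇ⇒≡ (weight v) k) (All.all-filter (T? ∘ λ v → weight v ≡ᵇ k) (allBits r)))

-- Entries of A Aᵀ on rows of equal weight

dot-≤ˡ : ∀ u v → dot u v ≤ weight u
dot-≤ˡ []          v           = z≤n
dot-≤ˡ (a ∷ u)     []          = z≤n
dot-≤ˡ (true ∷ u)  (true ∷ v)  = s≤s (dot-≤ˡ u v)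
dot-≤ˡ (true ∷ u)  (false ∷ v) = m≤n⇒m≤1+n (dot-≤ˡ u v)
dot-≤ˡ (false ∷ u) (b ∷ v)     = dot-≤ˡ u v

dot-≤ʳ : ∀ u v → dot u v ≤ weight v
dot-≤ʳ []          v           = z≤n
dot-≤ʳ (a ∷ u)     []          = z≤n
dot-≤ʳ (true ∷ u)  (true ∷ v)  = s≤s (dot-≤ʳ u v)
dot-≤ʳ (false ∷ u) (true ∷ v)  = m≤n⇒m≤1+n (dot-≤ʳ u v)
dot-≤ʳ (true ∷ u)  (false ∷ v) = dot-≤ʳ u v
dot-≤ʳ (false ∷ u) (false ∷ v) = dot-≤ʳ u v

dot-self : ∀ u → dot u u ≡ weight u
dot-self []          = refl
dot-self (true ∷ u)  = cong suc (dot-self u)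
dot-self (false ∷ u) = dot-self u

dot≡weight⇒≡ : ∀ u v → length u ≡ length v → dot u v ≡ weight u → dot u v ≡ weight v → u ≡ v
dot≡weight⇒≡ []          []          _ _  _  = refl
dot≡weight⇒≡ (true ∷ u)  (true ∷ v)  l du dv =
  cong (true ∷_) (dot≡weight⇒≡ u v (suc-injective l) (suc-injective du) (suc-injective dv))
dot≡weight⇒≡ (false ∷ u) (false ∷ v) l du dv = cong (false ∷_) (dot≡weight⇒≡ u v (suc-injective l) du dv)
dot≡weight⇒≡ (true ∷ u)  (false ∷ v) _ du _  = contradiction (subst (_≤ weight u) du (dot-≤ˡ u v)) 1+n≰n
dot≡weight⇒≡ (false ∷ u) (true ∷ v)  _ _  dv = contradiction (subst (_≤ weight v) dv (dot-≤ʳ u v)) 1+n≰n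

digit-2^ : ∀ i → digit i (2 ^ i) ≡ true
digit-2^ zero    = refl
digit-2^ (suc i) = trans (cong (digit i) (trans (cong (_/ 2) (*-comm 2 (2 ^ i))) (m*n/n≡m (2 ^ i) 2)))
                         (digit-2^ i)

digit-< : ∀ i {n} → n < 2 ^ i → digit i n ≡ false
digit-< zero    {zero}  _           = refl
digit-< zero    {suc n} (s≤s ())
digit-< (suc i) {n}     n<2^i       = digit-< i (m<n*o⇒m/o<n (subst (n <_) (*-comm 2 (2 ^ i)) n<2^i))

digit-dot-diagonal : ∀ i u → weight u ≡ 2 ^ i → digit i (dot u u) ≡ true
digit-dot-diagonal i u wu = trans (cong (digit i) (trans (dot-self u) wu)) (digit-2^ i)

digit-dot-off-diagonal : ∀ i u v → length u ≡ length v → weight u ≡ 2 ^ i → weight v ≡ 2 ^ i →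
                         u ≢ v → digit i (dot u v) ≡ false
digit-dot-off-diagonal i u v l wu wv u≢v = digit-< i (≤∧≢⇒< (subst (dot u v ≤_) wv (dot-≤ʳ u v))
  λ dot≡2^i → u≢v (dot≡weight⇒≡ u v l (trans dot≡2^i (sym wu)) (trans dot≡2^i (sym wv))))

keepCols-map : ∀ k Cs (f : List Bool → ℕ) → keepCols k Cs (map f Cs) ≡ map f (ofWeight k Cs)
keepCols-map k []       f = refl
keepCols-map k (a ∷ Cs) f with weight a ≡ᵇ k
... | true  = cong (f a ∷_) (keepCols-map k Cs f)
... | false = keepCols-map k Cs f

select-map-filterᵇ : ∀ {A : Set} (g : A → List Bool) (p : A → Bool) xs →
                     ∃ λ s → select (map g xs) s ≡ map g (filterᵇ p xs)
select-map-filterᵇ g p []       = Vec.[] , refl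
select-map-filterᵇ g p (x ∷ xs) with p x | select-map-filterᵇ g p xs
... | true  | s , eq = true  Vec.∷ s , cong (g x ∷_) eq
... | false | s , eq = false Vec.∷ s , eq

HasRankGF2-map-filterᵇ : ∀ {A : Set} (g : A → List Bool) (p : A → Bool) xs →
  LinIndep (map g (filterᵇ p xs)) → (∀ x → length (g x) ≡ length (filterᵇ p xs)) →
  HasRankGF2 (map g xs) (length (filterᵇ p xs))
HasRankGF2-map-filterᵇ g p xs independent width with select-map-filterᵇ g p xs
... | s , selected≡ = subst (HasRankGF2 (map g xs)) length-selected
  (LinIndep-select⇒HasRankGF2 (map g xs) s (subst LinIndep (sym selected≡) independent) short)
  where
  length-selected : length (select (map g xs) s) ≡ length (filterᵇ p xs)
  length-selected = trans (cong length selected≡) (List.length-map g (filterᵇ p xs))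
  short : All (λ x → length x ≤ length (select (map g xs) s)) (map g xs)
  short = All.map⁺ (All.universal (λ x → ≤-reflexive (trans (width x) (sym length-selected))) xs)

digitRow : ℕ → List (List Bool) → List Bool → List Bool
digitRow i W u = map (λ v → digit i (dot u v)) W

digitMat-frakm : ∀ r i k → digitMat i (frakm r k) ≡ map (digitRow i (ofWeight k (codeRows r))) (codeRows r)
digitMat-frakm r i k = trans (sym (List.map-∘ _)) (trans (sym (List.map-∘ Cs)) (List.map-cong row-of Cs))
  where
  Cs = codeRows r
  row-of : ∀ u → map (digit i) (keepCols k Cs (map (dot u) Cs)) ≡ digitRow i (ofWeight k Cs) u
  row-of u = trans (cong (map (digit i)) (keepCols-map k Cs (dot u))) (sym (List.map-∘ (ofWeight k Cs)))

digitRows-independent : ∀ r i → let W = ofWeight (2 ^ i) (codeRows r) in LinIndep (map (digitRow i W) W)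
digitRows-independent r i =
  identity-rows-independent {P = λ v → length v ≡ r × weight v ≡ 2 ^ i} (λ u v → digit i (dot u v))
    (λ {u} (_ , wu) → digit-dot-diagonal i u wu)
    (λ {u} {v} (lu , wu) (lv , wv) → digit-dot-off-diagonal i u v (trans lu (sym lv)) wu wv)
    (ofWeight-codeRows-shape r (2 ^ i)) (ofWeight-codeRows-unique r (2 ^ i))

lemma12 : (r : ℕ) → 1 ≤ r → (i : ℕ) → 1 ≤ i →
    HasRankGF2 (digitMat i (frakm r (2 ^ i))) (r C (2 ^ i))
lemma12 r _ i _ = subst₂ HasRankGF2 (sym (digitMat-frakm r i k)) (length-ofWeight-codeRows r k)
  (HasRankGF2-map-filterᵇ (digitRow i W) (λ v → weight v ≡ᵇ k) (codeRows r)
    (digitRows-independent r i) (λ u → List.length-map _ W))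
  where
  k = 2 ^ i
  W = ofWeight k (codeRows r)
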